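{- Let $N\in\mathbb N$, let $\mathcal U(8N+1)=\{(x,y)\in\mathbb Z^2:x^2+y^2=8N+1\}$, let $M'=\{(a,b)\in\mathbb Z^2:a+b\text{ even}\}$, let $\widehat{\mathcal B}_1'(N)=\{(q_1',q_2')\in\mathbb Z^2:2q_1'^2+2q_2'^2+q_2'=N\}$ and let $\varphi:\widehat{\mathcal B}_1'(N)\to\mathcal U(8N+1)$, $\varphi(q_1',q_2')=(4q_1',\,4q_2'+1)$. Then: (1) the action of the cyclic group $C_4=\langle r\rangle$, $r(x,y)=(-y,x)$, on $\mathcal U(8N+1)$ is free; (2) the sets $\varphi(\widehat{\mathcal B}_1'(N)\cap M')$ and $\varphi(\widehat{\mathcal B}_1'(N)\setminus M')$ are disjoint, and $\varphi(\widehat{\mathcal B}_1'(N))$ is a complete set of representatives of the $C_4$-orbits of $\mathcal U(8N+1)$.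
   Context: Origin: in type $C_2^{(1)}$ the (extended) $\Lambda_1$-atomic length of a translation $t_q$, $q=\sqrt2(q_1\varepsilon_1+q_2\varepsilon_2)$, is $4q_1^2+4q_2^2+q_1-q_2$; after the change of variables given by the isometry $u=\frac1{\sqrt2}\begin{pmatrix}1&1\\1&-1\end{pmatrix}$ the translation lattice of the extended affine Weyl group becomes $\mathbb Z^2$, the root lattice $M$ becomes $M'$, and the $\Lambda_1$-atomic length becomes $2q_1'^2+2q_2'^2+q_2'$. -}

module Defs where

open import Data.Nat using (ℕ; zero; suc)
open import Data.Integer using (ℤ; +_; _+_; _*_; -_)
open import Data.Integer.Divisibility using (_∣_)
open import Data.Fin using (Fin; toℕ)
open import Data.Product using (_×_; _,_; Σ; ∃)
open import Relation.Binary.PropositionalEquality using (_≡_)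
open import Relation.Nullary using (¬_)

ℤ² : Set
ℤ² = ℤ × ℤ

InU : ℕ → ℤ² → Set
InU N (x , y) = x * x + y * y ≡ + 8 * + N + + 1

InM' : ℤ² → Set
InM' (a , b) = + 2 ∣ (a + b)

InB : ℕ → ℤ² → Set
InB N (q₁ , q₂) = + 2 * (q₁ * q₁) + + 2 * (q₂ * q₂) + q₂ ≡ + N

φ : ℤ² → ℤ²
φ (q₁ , q₂) = (+ 4 * q₁ , + 4 * q₂ + + 1)

r : ℤ² → ℤ²
r (x , y) = (- y , x)

r^ : ℕ → ℤ² → ℤ²
r^ zero u = u
r^ (suc k) u = r (r^ k u)

act : Fin 4 → ℤ² → ℤ²
act k = r^ (toℕ k)

SameOrbit : ℤ² → ℤ² → Set
SameOrbit u v = ∃ λ (k : Fin 4) → act k u ≡ v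

FreeOnU : ℕ → Set
FreeOnU N = ∀ u → InU N u → (k : Fin 4) → act k u ≡ u → k ≡ Data.Fin.zero

CompleteReps : ℕ → (ℤ² → Set) → Set
CompleteReps N S =
  (∀ s → S s → InU N s)
  × (∀ u → InU N u → ∃ λ s → S s × SameOrbit s u)
  × (∀ s t → S s → S t → SameOrbit s t → s ≡ t)

Imφ : (ℤ² → Set) → ℤ² → Set
Imφ A u = ∃ λ q → A q × φ q ≡ u

-- The map φ is a bijection from B̂₁'(N) onto the points (x, y) of 𝒰(8N+1) with
-- x ≡ 0 and y ≡ 1 (mod 4), because |φ q|² = 8 (2q₁² + 2q₂² + q₂) + 1. Since squares
-- are 0, 1 or 4 mod 8, a point with x² + y² ≡ 1 (mod 8) has residues (0,1), (0,3),
-- (1,0) or (3,0) mod 4, and exactly one power of r moves such residues to (0,1).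
-- Freeness holds since the only point fixed by a nontrivial rotation is the origin,
-- which is not in 𝒰(8N+1).
module Submission where

open import Defs
open import Data.Nat using (ℕ)
open import Data.Product using (_×_; ∃; _,_; proj₁; proj₂)
open import Relation.Nullary using (¬_)

import Data.Nat as ℕ
import Data.Nat.Divisibility as ℕ
open import Data.Integer using (ℤ; +_; _+_; _*_; -_; _-_; +0; +[1+_]; -[1+_]; ∣_∣; _/ℕ_; _%ℕ_)
open import Data.Integer.Properties using (abs-*; neg-involutive; +-identityʳ; *-cancelˡ-≡; +-0-abelianGroup)
open import Algebra.Properties.AbelianGroup +-0-abelianGroup using () renaming (∙-cancelʳ to +-cancelʳ)
open import Data.Integer.DivMod using (a≡a%ℕn+[a/ℕn]*n; n%ℕd<d)
open import Data.Integer.Divisibility using (_∣_)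
open import Data.Integer.Tactic.RingSolver using (solve; solve-∀)
open import Data.Fin using (Fin; zero; suc; toℕ)
open import Data.Empty using (⊥-elim)
open import Data.Sum using (_⊎_; inj₁; inj₂)
open import Data.List using (_∷_; [])
open import Relation.Nullary.Decidable using (True; fromWitness)
open import Relation.Binary.PropositionalEquality
open import Function.Definitions using (Injective)

-- For literals m and n with m ∤ n the type True (m ∣? n) computes to ⊥.
∣⇒True∣? : ∀ {m n} → m ℕ.∣ n → True (m ℕ.∣? n)
∣⇒True∣? = fromWitness

∣*+≡*+⇒∣- : ∀ d K L C D → d * K + C ≡ d * L + D → d ∣ C - D
∣*+≡*+⇒∣- d K L C D eq = subst (d ∣_) (sym C-D≡d[L-K]) d∣d[L-K]
  where
  C-D≡d[L-K] : C - D ≡ d * (L - K)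
  C-D≡d[L-K] = begin
    C - D                      ≡⟨ solve (d ∷ K ∷ C ∷ D ∷ []) ⟩
    (d * K + C) - (d * K + D)  ≡⟨ cong (_- (d * K + D)) eq ⟩
    (d * L + D) - (d * K + D)  ≡⟨ solve (d ∷ K ∷ L ∷ D ∷ []) ⟩
    d * (L - K)                ∎
    where open ≡-Reasoning
  d∣d[L-K] : d ∣ d * (L - K)
  d∣d[L-K] = subst (∣ d ∣ ℕ.∣_) (sym (abs-* d (L - K))) (ℕ.m∣m*n ∣ L - K ∣)

-a≡a⇒a≡0 : ∀ {a} → - a ≡ a → a ≡ +0
-a≡a⇒a≡0 { +0 }       _  = refl
-a≡a⇒a≡0 { +[1+ _ ] } ()
-a≡a⇒a≡0 { -[1+ _ ] } ()

normSq : ℤ² → ℤ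
normSq (x , y) = x * x + y * y

atomicLength : ℤ² → ℤ
atomicLength (q₁ , q₂) = + 2 * (q₁ * q₁) + + 2 * (q₂ * q₂) + q₂

normSq-r : ∀ u → normSq (r u) ≡ normSq u
normSq-r (x , y) = rotation-invariance x y
  where
  rotation-invariance : ∀ x y → (- y) * (- y) + x * x ≡ x * x + y * y
  rotation-invariance = solve-∀

normSq-act : ∀ k u → normSq (act k u) ≡ normSq u
normSq-act k u = go (toℕ k)
  where
  go : ∀ n → normSq (r^ n u) ≡ normSq u
  go ℕ.zero    = refl
  go (ℕ.suc n) = trans (normSq-r (r^ n u)) (go n)

normSq-φ : ∀ q → normSq (φ q) ≡ + 8 * atomicLength q + + 1
normSq-φ (q₁ , q₂) = expand q₁ q₂
  where
  expand : ∀ q₁ q₂ → (+ 4 * q₁) * (+ 4 * q₁) + (+ 4 * q₂ + + 1) * (+ 4 * q₂ + + 1)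
                   ≡ + 8 * (+ 2 * (q₁ * q₁) + + 2 * (q₂ * q₂) + q₂) + + 1
  expand = solve-∀

InB⇒InU-φ : ∀ N q → InB N q → InU N (φ q)
InB⇒InU-φ N q hq = trans (normSq-φ q) (cong (λ l → + 8 * l + + 1) hq)

InU-φ⇒InB : ∀ N q → InU N (φ q) → InB N q
InU-φ⇒InB N q hu = *-cancelˡ-≡ (+ 8) _ _ (+-cancelʳ (+ 1) _ _ (trans (sym (normSq-φ q)) hu))

origin∉U : ∀ N → ¬ InU N (+0 , +0)
origin∉U N hu = ∣⇒True∣? (∣*+≡*+⇒∣- (+ 8) +0 (+ N) +0 (+ 1) hu)

fixedPoint⇒origin : ∀ (k : Fin 4) u → act k u ≡ u → k ≡ zero ⊎ u ≡ (+0 , +0)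
fixedPoint⇒origin zero u _ = inj₁ refl
fixedPoint⇒origin (suc zero) (x , y) fix = inj₂ (cong₂ _,_ (trans x≡y y≡0) y≡0)
  where
  x≡y : x ≡ y
  x≡y = cong proj₂ fix
  y≡0 : y ≡ +0
  y≡0 = -a≡a⇒a≡0 (trans (cong proj₁ fix) x≡y)
fixedPoint⇒origin (suc (suc zero)) (x , y) fix =
  inj₂ (cong₂ _,_ (-a≡a⇒a≡0 (cong proj₁ fix)) (-a≡a⇒a≡0 (cong proj₂ fix)))
fixedPoint⇒origin (suc (suc (suc zero))) (x , y) fix = inj₂ (cong₂ _,_ x≡0 (trans y≡x x≡0))
  where
  y≡x : y ≡ x
  y≡x = trans (sym (neg-involutive y)) (cong proj₁ fix)
  x≡0 : x ≡ +0
  x≡0 = -a≡a⇒a≡0 (trans (cong proj₂ fix) y≡x)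

data UnitResidues : ℕ → ℕ → Set where
  ⟨0,1⟩ : UnitResidues 0 1
  ⟨0,3⟩ : UnitResidues 0 3
  ⟨1,0⟩ : UnitResidues 1 0
  ⟨3,0⟩ : UnitResidues 3 0

unitResidues : ∀ {i j} → i ℕ.< 4 → j ℕ.< 4 → + 8 ∣ (+ i * + i + + j * + j) - + 1
  → UnitResidues i j
unitResidues {0} {0} _ _ 8∣ = ⊥-elim (∣⇒True∣? 8∣)
unitResidues {0} {1} _ _ _  = ⟨0,1⟩
unitResidues {0} {2} _ _ 8∣ = ⊥-elim (∣⇒True∣? 8∣)
unitResidues {0} {3} _ _ _  = ⟨0,3⟩
unitResidues {1} {0} _ _ _  = ⟨1,0⟩
unitResidues {1} {1} _ _ 8∣ = ⊥-elim (∣⇒True∣? 8∣)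
unitResidues {1} {2} _ _ 8∣ = ⊥-elim (∣⇒True∣? 8∣)
unitResidues {1} {3} _ _ 8∣ = ⊥-elim (∣⇒True∣? 8∣)
unitResidues {2} {0} _ _ 8∣ = ⊥-elim (∣⇒True∣? 8∣)
unitResidues {2} {1} _ _ 8∣ = ⊥-elim (∣⇒True∣? 8∣)
unitResidues {2} {2} _ _ 8∣ = ⊥-elim (∣⇒True∣? 8∣)
unitResidues {2} {3} _ _ 8∣ = ⊥-elim (∣⇒True∣? 8∣)
unitResidues {3} {0} _ _ _  = ⟨3,0⟩
unitResidues {3} {1} _ _ 8∣ = ⊥-elim (∣⇒True∣? 8∣)
unitResidues {3} {2} _ _ 8∣ = ⊥-elim (∣⇒True∣? 8∣)
unitResidues {3} {3} _ _ 8∣ = ⊥-elim (∣⇒True∣? 8∣)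
unitResidues {ℕ.suc (ℕ.suc (ℕ.suc (ℕ.suc _)))} (ℕ.s≤s (ℕ.s≤s (ℕ.s≤s (ℕ.s≤s ())))) _ _
unitResidues {j = ℕ.suc (ℕ.suc (ℕ.suc (ℕ.suc _)))} _ (ℕ.s≤s (ℕ.s≤s (ℕ.s≤s (ℕ.s≤s ())))) _

InU⇒8∣residues : ∀ N i j a b → InU N (+ i + a * + 4 , + j + b * + 4)
  → + 8 ∣ (+ i * + i + + j * + j) - + 1
InU⇒8∣residues N i j a b hu =
  ∣*+≡*+⇒∣- (+ 8) K (+ N) (+ i * + i + + j * + j) (+ 1) (trans (sym (expand (+ i) (+ j) a b)) hu)
  where
  K : ℤ
  K = + 2 * (a * a) + a * + i + + 2 * (b * b) + b * + j
  expand : ∀ i j a b → (i + a * + 4) * (i + a * + 4) + (j + b * + 4) * (j + b * + 4)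
           ≡ + 8 * (+ 2 * (a * a) + a * i + + 2 * (b * b) + b * j) + (i * i + j * j)
  expand = solve-∀

divMod4 : ∀ x → ∃ λ a → ∃ λ i → i ℕ.< 4 × x ≡ + i + a * + 4
divMod4 x = x /ℕ 4 , x %ℕ 4 , n%ℕd<d x 4 , a≡a%ℕn+[a/ℕn]*n x 4

rotateFromφ : ∀ {i j} a b → UnitResidues i j
  → ∃ λ q → ∃ λ (k : Fin 4) → act k (φ q) ≡ (+ i + a * + 4 , + j + b * + 4)
rotateFromφ a b ⟨0,1⟩ = (a , b) , zero , rotation
  where
  rotation : (+ 4 * a , + 4 * b + + 1) ≡ (+ 0 + a * + 4 , + 1 + b * + 4)
  rotation = cong₂ _,_ (solve (a ∷ [])) (solve (b ∷ []))
rotateFromφ a b ⟨0,3⟩ = (- a , - b - + 1) , suc (suc zero) , rotation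
  where
  rotation : (- (+ 4 * - a) , - (+ 4 * (- b - + 1) + + 1)) ≡ (+ 0 + a * + 4 , + 3 + b * + 4)
  rotation = cong₂ _,_ (solve (a ∷ [])) (solve (b ∷ []))
rotateFromφ a b ⟨1,0⟩ = (- b , a) , suc (suc (suc zero)) , rotation
  where
  rotation : (- - (+ 4 * a + + 1) , - (+ 4 * - b)) ≡ (+ 1 + a * + 4 , + 0 + b * + 4)
  rotation = cong₂ _,_ (solve (a ∷ [])) (solve (b ∷ []))
rotateFromφ a b ⟨3,0⟩ = (b , - a - + 1) , suc zero , rotation
  where
  rotation : (- (+ 4 * (- a - + 1) + + 1) , + 4 * b) ≡ (+ 3 + a * + 4 , + 0 + b * + 4)
  rotation = cong₂ _,_ (solve (a ∷ [])) (solve (b ∷ []))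

φ-orbit-covers : ∀ N u → InU N u → ∃ λ s → Imφ (InB N) s × SameOrbit s u
φ-orbit-covers N (x , y) hu with divMod4 x | divMod4 y
... | a , i , i<4 , refl | b , j , j<4 , refl
  with q , k , act-k-φq≡u ← rotateFromφ a b (unitResidues i<4 j<4 (InU⇒8∣residues N i j a b hu)) =
  φ q , (q , InU-φ⇒InB N q hφq , refl) , k , act-k-φq≡u
  where
  hφq : InU N (φ q)
  hφq = trans (sym (normSq-act k (φ q))) (trans (cong normSq act-k-φq≡u) hu)

act-φ≡φ⇒identity : ∀ q q' (k : Fin 4) → act k (φ q) ≡ φ q' → k ≡ zero
act-φ≡φ⇒identity q q' zero _ = refl
act-φ≡φ⇒identity (a , b) (c , d) (suc zero) e =
  ⊥-elim (∣⇒True∣? (∣*+≡*+⇒∣- (+ 4) a d +0 (+ 1) y-coords))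
  where
  y-coords : + 4 * a + +0 ≡ + 4 * d + + 1
  y-coords = trans (+-identityʳ (+ 4 * a)) (cong proj₂ e)
act-φ≡φ⇒identity (a , b) (c , d) (suc (suc zero)) e =
  ⊥-elim (∣⇒True∣? (∣*+≡*+⇒∣- (+ 4) (- b) d (- + 1) (+ 1) y-coords))
  where
  negate : ∀ b → + 4 * (- b) + - + 1 ≡ - (+ 4 * b + + 1)
  negate = solve-∀
  y-coords : + 4 * (- b) + - + 1 ≡ + 4 * d + + 1
  y-coords = trans (negate b) (cong proj₂ e)
act-φ≡φ⇒identity (a , b) (c , d) (suc (suc (suc zero))) e =
  ⊥-elim (∣⇒True∣? (∣*+≡*+⇒∣- (+ 4) b c (+ 1) +0 x-coords))
  where
  x-coords : + 4 * b + + 1 ≡ + 4 * c + +0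
  x-coords = trans (sym (neg-involutive _)) (trans (cong proj₁ e) (sym (+-identityʳ (+ 4 * c))))

act-free-on-U : ∀ N → FreeOnU N
act-free-on-U N u hu k fix with fixedPoint⇒origin k u fix
... | inj₁ k≡0  = k≡0
... | inj₂ refl = ⊥-elim (origin∉U N hu)

φ-injective : Injective _≡_ _≡_ φ
φ-injective {a , b} {c , d} e =
  cong₂ _,_ (*-cancelˡ-≡ (+ 4) a c (cong proj₁ e))
            (*-cancelˡ-≡ (+ 4) b d (+-cancelʳ (+ 1) _ _ (cong proj₂ e)))

theorem8p12 : (N : ℕ)
    → FreeOnU N
    × (¬ ∃ (λ u → Imφ (λ q → InB N q × InM' q) u × Imφ (λ q → InB N q × ¬ InM' q) u))
    × CompleteReps N (Imφ (InB N))
theorem8p12 N = act-free-on-U N , disjoint , reps⊆U , φ-orbit-covers N , distinctOrbits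
  where
  disjoint : ¬ ∃ (λ u → Imφ (λ q → InB N q × InM' q) u × Imφ (λ q → InB N q × ¬ InM' q) u)
  disjoint (_ , (q , (_ , q∈M') , refl) , (q' , (_ , q'∉M') , φq'≡φq)) =
    q'∉M' (subst InM' (φ-injective (sym φq'≡φq)) q∈M')
  reps⊆U : ∀ s → Imφ (InB N) s → InU N s
  reps⊆U _ (q , q∈B , refl) = InB⇒InU-φ N q q∈B
  distinctOrbits : ∀ s t → Imφ (InB N) s → Imφ (InB N) t → SameOrbit s t → s ≡ t
  distinctOrbits _ _ (q , _ , refl) (q' , _ , refl) (k , e) with act-φ≡φ⇒identity q q' k e
  ... | refl = e
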